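{- Let $k\ge s\ge r\ge 1$ be fixed integers and let $H$ be a fixed $s$-uniform hypergraph with $k$ vertices and $m\ge 1$ edges. Then for every strategy $\mathcal S$ and every $t=t(n)$ with $t=o\left(n^{r-(k-s+r)/m}\right)$, asymptotically almost surely $G^{(r,s)}_t$ (played according to $\mathcal S$) contains no copy of $H$. Consequently $\tau^{(r)}(H)\ge n^{r-(k-s+r)/m}$.
   Context: Semi-random hypergraph process: fix integers $1\le r\le s$. Start with the empty hypergraph on vertex set $[n]=\{1,\dots,n\}$. In each round $t=1,2,\dots$ a set $U_t$ of $r$ vertices is chosen uniformly at random from all $r$-subsets of $[n]$, independently of everything before; the player then chooses a set $V_t$ of $s-r$ vertices (so that $U_t\cup V_t$ has $s$ elements; if $r=s$ then $V_t=\emptyset$), and the edge $U_t\cup V_t$ is added (parallel edges are allowed). A strategy is a rule specifying, for each $n$ and $t$, $V_t$ as a function of $U_1,V_1,\dots,U_{t-1},V_{t-1},U_t$. $G^{(r,s)}_t$ denotes the resulting multi-$s$-graph after $t$ rounds. "Asymptotically almost surely" (a.a.s.) means with probability tending to $1$ as $n\to\infty$. $\tau^{(r)}(H)$ denotes a threshold for the property of containing a copy of $H$: a function $\tau(n)$ such that (a) some strategy gives a.a.s. $H\subseteq G^{(r,s)}_t$ whenever $t\gg\tau$, and (b) for every strategy, a.a.s. $H\not\subseteq G^{(r,s)}_t$ whenever $t=o(\tau)$. The notation $\tau^{(r)}(H)\ge f(n)$ means that for every strategy and every $t=o(f)$, a.a.s. $G^{(r,s)}_t$ contains no copy of $H$.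 -}

module Defs where

open import Data.Nat using (ℕ; zero; suc; _+_; _*_; _∸_; _^_; _≤_)
open import Data.Nat.Combinatorics using (_C_)
open import Data.Fin using (Fin)
open import Data.Fin.Subset using (Subset; _∪_; _∩_; ∣_∣; _∈_; ⊥)
open import Data.List using (List; []; _∷_; _++_; [_]; map; length)
open import Data.List.Relation.Unary.All using (All)
open import Data.List.Relation.Unary.Any using (Any)
open import Data.List.Relation.Unary.Unique.Propositional using (Unique)
open import Data.Vec using (Vec; toList)
open import Data.Product using (Σ; ∃; ∃-syntax; _×_; _,_)
open import Relation.Binary.PropositionalEquality using (_≡_)
open import Function.Definitions using (Injective)

-- A (deterministic) strategy: for each n, given the history
-- (U_1,V_1),...,(U_{t-1},V_{t-1}) and the current random r-set U_t,
-- it returns V_t.  (t is the length of the history plus one.)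
Strategy : Set
Strategy = (n : ℕ) → List (Subset n × Subset n) → Subset n → Subset n

ValidStrategy : ℕ → ℕ → Strategy → Set
ValidStrategy r s S =
  (n : ℕ) → s ≤ n → (hist : List (Subset n × Subset n)) (U : Subset n) →
  ∣ U ∣ ≡ r → (∣ S n hist U ∣ ≡ s ∸ r) × (U ∩ S n hist U ≡ ⊥)

play : (S : Strategy) (n : ℕ) → List (Subset n × Subset n) →
       List (Subset n) → List (Subset n × Subset n)
play S n hist []       = hist
play S n hist (U ∷ Us) = play S n (hist ++ [ (U , S n hist U) ]) Us

edgeOf : {n : ℕ} → Subset n × Subset n → Subset n
edgeOf (U , V) = U ∪ V

-- The edge multiset (as a list) of G_t^{(r,s)} given U_1,...,U_t.
hyperEdges : (S : Strategy) (n t : ℕ) → Vec (Subset n) t → List (Subset n)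
hyperEdges S n t Us = map edgeOf (play S n [] (toList Us))

IsImage : {k n : ℕ} → (Fin k → Fin n) → Subset k → Subset n → Set
IsImage {k} φ e f =
  ((y : _) → y ∈ f → ∃[ x ] (x ∈ e × φ x ≡ y)) ×
  ((x : Fin k) → x ∈ e → φ x ∈ f)

ContainsCopy : (k n : ℕ) → List (Subset k) → List (Subset n) → Set
ContainsCopy k n HE GE =
  Σ (Fin k → Fin n) λ φ →
    Injective _≡_ _≡_ φ × All (λ e → Any (λ f → IsImage φ e f) GE) HE

RSeq : (r n t : ℕ) → Vec (Subset n) t → Set
RSeq r n t Us = All (λ U → ∣ U ∣ ≡ r) (toList Us)

-- t(n) = o(n^(r - (k-s+r)/m)), written without reals:
-- for every j, eventually (j+1) · t(n)^m · n^(k-s+r) ≤ n^(r·m).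
LittleO : (k s r m : ℕ) → (ℕ → ℕ) → Set
LittleO k s r m t =
  (j : ℕ) → ∃[ N ] ((n : ℕ) → N ≤ n →
    suc j * (t n ^ m * n ^ (k ∸ s + r)) ≤ n ^ (r * m))

-- A.a.s. G_t (played by S) contains no copy of H: for every j, eventually
-- the number of outcomes (U_1..U_t) yielding a copy of H is at most
-- (1/(j+1)) · (n choose r)^t.  Counting is expressed by: every duplicate-free
-- list of bad outcomes has length ≤ (n C r)^t / (j+1).
AASNoCopy : (k s r : ℕ) → List (Subset k) → Strategy → (ℕ → ℕ) → Set
AASNoCopy k s r HE S t =
  (j : ℕ) → ∃[ N ] ((n : ℕ) → N ≤ n →
    (L : List (Vec (Subset n) (t n))) → Unique L →
    All (λ Us → RSeq r n (t n) Us × ContainsCopy k n HE (hyperEdges S n (t n) Us)) L →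
    suc j * length L ≤ (n C r) ^ t n)

{-# OPTIONS --safe #-}
module Submission where

-- A first-moment count.  Suppose a copy φ(H) appears in G_t, and let f = φ(e) be the first of its
-- edges to be played.  With X = φ([k] ∖ e), a set of at most k − s vertices, the whole copy lies in
-- Y = f ∪ X, which has at most k vertices, and each of the other m − 1 edges (distinct, as φ is
-- injective) is played at its own later step, whose random r-set then lies in Y.  So the bad outcomes
-- (U_1, …, U_t) are covered by choosing the step of f (t ways), the set X (at most (2n)^(k−s) ways) and
-- m − 1 later steps whose r-sets are among the 2^k subsets of Y, all other steps being free.  With
-- N = (n choose r) ≥ n^r / (2^r r!), the fraction of bad outcomes is O(t^m n^(k−s+r) / n^(rm)), which
-- tends to 0 by the hypothesis on t.

open import Defs
open import Data.Bool using (true)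
open import Data.Bool.Properties using () renaming (_≟_ to _≟ᵇ_)
open import Data.Empty using (⊥-elim)
open import Data.Fin using (Fin; zero; suc)
open import Data.Fin.Subset as Sub using (Subset; inside; outside; ∣_∣; _⊆_; _∪_; ∁; ⁅_⁆)
  renaming (_∈_ to _∈ₛ_)
open import Data.Fin.Subset.Properties
  using (_⊆?_; drop-∷-⊆; ⊆-antisym; p⊆p∪q; q⊆p∪q; x∈⁅x⁆; x∈⁅y⁆⇒x≡y; x∈p∪q⁻; ∉⊥; x∉p⇒x∈∁p;
         ∣⁅x⁆∣≡1; ∣⊥∣≡0; ∣∁p∣≡n∸∣p∣)
  renaming (_∈?_ to _∈ₛ?_)
open import Data.List using (List; []; _∷_; _++_; [_]; map; concatMap; length; filter)
open import Data.List.Properties using (length-map; length-++; length-removeAt′; ++-identityʳ; ++-assoc; map-++)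
open import Data.List.Membership.Propositional using (_∈_; _─_; lose)
open import Data.List.Membership.Propositional.Properties
  using (∈-map⁺; ∈-map⁻; ∈-++⁺ˡ; ∈-++⁺ʳ; ∈-concatMap⁺; ∈-filter⁺)
open import Data.List.Relation.Unary.All as All using (All; []; _∷_)
import Data.List.Relation.Unary.All.Properties as All
open import Data.List.Relation.Unary.AllPairs using ([]; _∷_)
open import Data.List.Relation.Unary.Any as Any using (here; there; index)
open import Data.List.Relation.Unary.Unique.Propositional using (Unique)
import Data.List.Relation.Unary.Unique.Propositional.Properties as Unique
open import Data.Nat using (ℕ; zero; suc; _+_; _*_; _∸_; _^_; _!; _≤_; _≤?_; _≤ᵇ_; z≤n; s≤s; s≤s⁻¹; NonZero; >-nonZero)
open import Data.Nat.Combinatorics using (_C_; nCk+nC[k+1]≡[n+1]C[k+1]; nCk≡nPk/k!)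
open import Data.Nat.Combinatorics.Base using (_P_; _P′_)
open import Data.Nat.Combinatorics.Specification using (k!∣nP′k)
open import Data.Nat.DivMod using (_/_; m/n*n≡m)
open import Data.Nat.Properties
open import Algebra.Properties.CommutativeSemigroup *-commutativeSemigroup using (x∙yz≈y∙xz; interchange)
open import Data.Nat.Tactic.RingSolver using (solve-∀)
open import Data.Product using (_×_; _,_; ∃-syntax; proj₁; proj₂)
open import Data.Sum using (inj₁; inj₂)
open import Data.Vec using (Vec; []; _∷_; toList; count)
import Data.Vec.Base as V
open import Data.Vec.Properties using (≡-dec)
open import Function using (_∘_)
open import Function.Definitions using (Injective)
open import Relation.Binary.PropositionalEquality
  using (_≡_; _≢_; refl; sym; trans; cong; cong₂; subst; module ≡-Reasoning)
open import Relation.Nullary using (yes; no)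
open import Relation.Unary using (Decidable)

length-++-* : ∀ {A : Set} (xs : List A) {ys} M → length (xs ++ ys) * M ≡ length xs * M + length ys * M
length-++-* xs {ys} M = trans (cong (_* M) (length-++ xs)) (*-distribʳ-+ M (length xs) (length ys))

module _ {A : Set} where

  ∈-─⁺ : ∀ {x y} {ys : List A} (x∈ys : x ∈ ys) → y ∈ ys → x ≢ y → y ∈ ys ─ x∈ys
  ∈-─⁺ (here refl)  (here refl)  x≢y = ⊥-elim (x≢y refl)
  ∈-─⁺ (here _)     (there y∈ys) _   = y∈ys
  ∈-─⁺ (there _)    (here y≡z)   _   = here y≡z
  ∈-─⁺ (there x∈ys) (there y∈ys) x≢y = there (∈-─⁺ x∈ys y∈ys x≢y)

  length-≤-unique : ∀ {xs ys : List A} → Unique xs → All (_∈ ys) xs → length xs ≤ length ys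
  length-≤-unique [] [] = z≤n
  length-≤-unique {x ∷ xs} {ys} (x≢xs ∷ xs-unique) (x∈ys ∷ xs⊆ys) = begin
    suc (length xs)          ≤⟨ s≤s (length-≤-unique xs-unique xs⊆ys─x) ⟩
    suc (length (ys ─ x∈ys)) ≡⟨ length-removeAt′ ys (index x∈ys) ⟨
    length ys                ∎
    where
    open ≤-Reasoning
    xs⊆ys─x = All.zipWith (λ (x≢y , y∈ys) → ∈-─⁺ x∈ys y∈ys x≢y) (x≢xs , xs⊆ys)

  ∈-∷⁻ : ∀ {x y} {ys : List A} → x ∈ y ∷ ys → x ≢ y → x ∈ ys
  ∈-∷⁻ (here x≡y)   x≢y = ⊥-elim (x≢y x≡y)
  ∈-∷⁻ (there x∈ys) _   = x∈ys

  ∈-∷-filter⁺ : ∀ {P : A → Set} (P? : Decidable P) {x y ys} → x ∈ y ∷ ys → P x → x ∈ y ∷ filter P? ys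
  ∈-∷-filter⁺ P? (here x≡y)   _  = here x≡y
  ∈-∷-filter⁺ P? (there x∈ys) Px = there (∈-filter⁺ P? x∈ys Px)

  length-concatMap-≤ : ∀ {B : Set} (F : A → List B) (xs : List A) {M b} →
                       (∀ x → length (F x) * M ≤ b) → length (concatMap F xs) * M ≤ length xs * b
  length-concatMap-≤ F [] bound = z≤n
  length-concatMap-≤ F (x ∷ xs) {M} {b} bound = begin
    length (F x ++ concatMap F xs) * M              ≡⟨ length-++-* (F x) M ⟩
    length (F x) * M + length (concatMap F xs) * M  ≤⟨ +-mono-≤ (bound x) (length-concatMap-≤ F xs bound) ⟩
    b + length xs * b                               ∎
    where open ≤-Reasoning

^-distribʳ-* : ∀ a b c → (a * b) ^ c ≡ a ^ c * b ^ c
^-distribʳ-* a b zero    = refl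
^-distribʳ-* a b (suc c) = trans (cong (a * b *_) (^-distribʳ-* a b c)) (interchange a b (a ^ c) (b ^ c))

nCk*k!≡nP′k : ∀ {n k} → k ≤ n → (n C k) * k ! ≡ n P′ k
nCk*k!≡nP′k {n} {k} k≤n = begin
  (n C k) * k !         ≡⟨ cong (_* k !) (nCk≡nPk/k! k≤n) ⟩
  (n P k) / k ! * k !   ≡⟨ cong (λ x → x / k ! * k !) nPk≡nP′k ⟩
  (n P′ k) / k ! * k !  ≡⟨ m/n*n≡m (k!∣nP′k k≤n) ⟩
  n P′ k                ∎
  where
  open ≡-Reasoning
  instance _ = k !≢0
  nPk≡nP′k : n P k ≡ n P′ k
  nPk≡nP′k with k ≤ᵇ n | ≤⇒≤ᵇ k≤n
  ... | true | _ = refl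

[n∸k]^k≤nP′k : ∀ n k → (n ∸ k) ^ k ≤ n P′ k
[n∸k]^k≤nP′k n zero    = ≤-refl
[n∸k]^k≤nP′k n (suc k) = *-mono-≤ (∸-monoʳ-≤ n (n≤1+n k))
                           (≤-trans (^-monoˡ-≤ k (∸-monoʳ-≤ n (n≤1+n k))) ([n∸k]^k≤nP′k n k))

n^k≤2^k*k!*nCk : ∀ {n k} → 2 * k ≤ n → n ^ k ≤ 2 ^ k * k ! * (n C k)
n^k≤2^k*k!*nCk {n} {k} 2k≤n = begin
  n ^ k                    ≤⟨ ^-monoˡ-≤ k n≤2[n∸k] ⟩
  (2 * (n ∸ k)) ^ k        ≡⟨ ^-distribʳ-* 2 (n ∸ k) k ⟩
  2 ^ k * (n ∸ k) ^ k      ≤⟨ *-monoʳ-≤ (2 ^ k) ([n∸k]^k≤nP′k n k) ⟩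
  2 ^ k * (n P′ k)         ≡⟨ cong (2 ^ k *_) (nCk*k!≡nP′k k≤n) ⟨
  2 ^ k * ((n C k) * k !)  ≡⟨ cong (2 ^ k *_) (*-comm (n C k) (k !)) ⟩
  2 ^ k * (k ! * (n C k))  ≡⟨ *-assoc (2 ^ k) (k !) (n C k) ⟨
  2 ^ k * k ! * (n C k)    ∎
  where
  open ≤-Reasoning
  k+k≤n : k + k ≤ n
  k+k≤n = subst (_≤ n) (cong (k +_) (+-identityʳ k)) 2k≤n
  k≤n : k ≤ n
  k≤n = m+n≤o⇒m≤o k k+k≤n
  n≤2[n∸k] : n ≤ 2 * (n ∸ k)
  n≤2[n∸k] = begin
    n                      ≡⟨ m∸n+n≡m k≤n ⟨
    (n ∸ k) + k            ≤⟨ +-monoʳ-≤ (n ∸ k) (m+n≤o⇒m≤o∸n k k+k≤n) ⟩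
    (n ∸ k) + (n ∸ k)      ≡⟨ cong ((n ∸ k) +_) (+-identityʳ (n ∸ k)) ⟨
    2 * (n ∸ k)            ∎

≤-from-ratio : ∀ {a b c x M J} j .{{_ : NonZero x}} →
               a * x ≤ c * b * M → suc j * c ≤ J → J * b ≤ x → suc j * a ≤ M
≤-from-ratio {a} {b} {c} {x} {M} {J} j a*x≤c*b*M [1+j]*c≤J J*b≤x = *-cancelʳ-≤ (suc j * a) M x (begin
  suc j * a * x          ≡⟨ *-assoc (suc j) a x ⟩
  suc j * (a * x)        ≤⟨ *-monoʳ-≤ (suc j) a*x≤c*b*M ⟩
  suc j * (c * b * M)    ≡⟨ regroup (suc j) c b M ⟩
  suc j * c * b * M      ≤⟨ *-monoˡ-≤ M (*-monoˡ-≤ b [1+j]*c≤J) ⟩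
  J * b * M              ≤⟨ *-monoˡ-≤ M J*b≤x ⟩
  x * M                  ≡⟨ *-comm x M ⟩
  M * x                  ∎)
  where
  open ≤-Reasoning
  regroup : ∀ i c b M → i * (c * b * M) ≡ i * c * b * M
  regroup = solve-∀

module _ {n : ℕ} where

  infixr 5 _⊎ₛ_
  _⊎ₛ_ : List (Subset n) → List (Subset n) → List (Subset (suc n))
  xs ⊎ₛ ys = map (outside ∷_) xs ++ map (inside ∷_) ys

  length-⊎ₛ : ∀ xs ys → length (xs ⊎ₛ ys) ≡ length xs + length ys
  length-⊎ₛ xs ys = begin
    length (map (outside ∷_) xs ++ map (inside ∷_) ys)          ≡⟨ length-++ (map (outside ∷_) xs) ⟩
    length (map (outside ∷_) xs) + length (map (inside ∷_) ys)  ≡⟨ cong₂ _+_ (length-map _ xs) (length-map _ ys) ⟩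
    length xs + length ys                                       ∎
    where open ≡-Reasoning

  ∈-⊎ₛ-outside : ∀ {U xs} ys → U ∈ xs → outside ∷ U ∈ xs ⊎ₛ ys
  ∈-⊎ₛ-outside ys U∈xs = ∈-++⁺ˡ (∈-map⁺ _ U∈xs)

  ∈-⊎ₛ-inside : ∀ {U ys} xs → U ∈ ys → inside ∷ U ∈ xs ⊎ₛ ys
  ∈-⊎ₛ-inside xs U∈ys = ∈-++⁺ʳ (map (outside ∷_) xs) (∈-map⁺ _ U∈ys)

subsetsOf : ∀ {n} → Subset n → List (Subset n)
subsetsOf []            = [ [] ]
subsetsOf (outside ∷ Y) = subsetsOf Y ⊎ₛ []
subsetsOf (inside ∷ Y)  = subsetsOf Y ⊎ₛ subsetsOf Y

∈-subsetsOf : ∀ {n} {U Y : Subset n} → U ⊆ Y → U ∈ subsetsOf Y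
∈-subsetsOf {U = []}          {[]}          _   = here refl
∈-subsetsOf {U = outside ∷ U} {outside ∷ Y} U⊆Y = ∈-⊎ₛ-outside [] (∈-subsetsOf (drop-∷-⊆ U⊆Y))
∈-subsetsOf {U = inside ∷ U}  {outside ∷ Y} U⊆Y with () ← U⊆Y V.here
∈-subsetsOf {U = outside ∷ U} {inside ∷ Y}  U⊆Y = ∈-⊎ₛ-outside _ (∈-subsetsOf (drop-∷-⊆ U⊆Y))
∈-subsetsOf {U = inside ∷ U}  {inside ∷ Y}  U⊆Y = ∈-⊎ₛ-inside _ (∈-subsetsOf (drop-∷-⊆ U⊆Y))

length-subsetsOf : ∀ {n} (Y : Subset n) → length (subsetsOf Y) ≡ 2 ^ ∣ Y ∣
length-subsetsOf []            = refl
length-subsetsOf (outside ∷ Y) = trans (length-⊎ₛ (subsetsOf Y) []) (trans (+-identityʳ _) (length-subsetsOf Y))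
length-subsetsOf (inside ∷ Y)  = begin
  length (subsetsOf Y ⊎ₛ subsetsOf Y)           ≡⟨ length-⊎ₛ (subsetsOf Y) (subsetsOf Y) ⟩
  length (subsetsOf Y) + length (subsetsOf Y)   ≡⟨ cong (λ l → l + l) (length-subsetsOf Y) ⟩
  2 ^ ∣ Y ∣ + 2 ^ ∣ Y ∣                         ≡⟨ cong (2 ^ ∣ Y ∣ +_) (+-identityʳ (2 ^ ∣ Y ∣)) ⟨
  2 ^ suc ∣ Y ∣                                 ∎
  where open ≡-Reasoning

subsetsOfSize : (n c : ℕ) → List (Subset n)
subsetsOfSize zero    zero    = [ [] ]
subsetsOfSize zero    (suc c) = []
subsetsOfSize (suc n) zero    = subsetsOfSize n zero ⊎ₛ []
subsetsOfSize (suc n) (suc c) = subsetsOfSize n (suc c) ⊎ₛ subsetsOfSize n c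

∈-subsetsOfSize : ∀ {n} c (U : Subset n) → ∣ U ∣ ≡ c → U ∈ subsetsOfSize n c
∈-subsetsOfSize zero    []            _       = here refl
∈-subsetsOfSize zero    (outside ∷ U) ∣U∣≡0   = ∈-⊎ₛ-outside [] (∈-subsetsOfSize zero U ∣U∣≡0)
∈-subsetsOfSize (suc c) (outside ∷ U) ∣U∣≡1+c = ∈-⊎ₛ-outside _ (∈-subsetsOfSize (suc c) U ∣U∣≡1+c)
∈-subsetsOfSize (suc c) (inside ∷ U)  ∣U∣≡1+c = ∈-⊎ₛ-inside _ (∈-subsetsOfSize c U (suc-injective ∣U∣≡1+c))

length-subsetsOfSize : ∀ n c → length (subsetsOfSize n c) ≡ n C c
length-subsetsOfSize zero    zero    = refl
length-subsetsOfSize zero    (suc c) = refl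
length-subsetsOfSize (suc n) zero    =
  trans (length-⊎ₛ (subsetsOfSize n zero) []) (trans (+-identityʳ _) (length-subsetsOfSize n zero))
length-subsetsOfSize (suc n) (suc c) = begin
  length (subsetsOfSize n (suc c) ⊎ₛ subsetsOfSize n c)          ≡⟨ length-⊎ₛ (subsetsOfSize n (suc c)) _ ⟩
  length (subsetsOfSize n (suc c)) + length (subsetsOfSize n c)  ≡⟨ cong₂ _+_ (length-subsetsOfSize n (suc c))
                                                                             (length-subsetsOfSize n c) ⟩
  n C suc c + n C c                                              ≡⟨ +-comm (n C suc c) (n C c) ⟩
  n C c + n C suc c                                              ≡⟨ nCk+nC[k+1]≡[n+1]C[k+1] n c ⟩
  suc n C suc c                                                  ∎
  where open ≡-Reasoning

subsetsOfSize≤ : (n c : ℕ) → List (Subset n)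
subsetsOfSize≤ zero    c       = [ [] ]
subsetsOfSize≤ (suc n) zero    = subsetsOfSize≤ n zero ⊎ₛ []
subsetsOfSize≤ (suc n) (suc c) = subsetsOfSize≤ n (suc c) ⊎ₛ subsetsOfSize≤ n c

∈-subsetsOfSize≤ : ∀ {n} c (U : Subset n) → ∣ U ∣ ≤ c → U ∈ subsetsOfSize≤ n c
∈-subsetsOfSize≤ c       []            _            = here refl
∈-subsetsOfSize≤ zero    (outside ∷ U) ∣U∣≤0        = ∈-⊎ₛ-outside [] (∈-subsetsOfSize≤ zero U ∣U∣≤0)
∈-subsetsOfSize≤ (suc c) (outside ∷ U) ∣U∣≤1+c      = ∈-⊎ₛ-outside _ (∈-subsetsOfSize≤ (suc c) U ∣U∣≤1+c)
∈-subsetsOfSize≤ (suc c) (inside ∷ U)  (s≤s ∣U∣≤c) = ∈-⊎ₛ-inside _ (∈-subsetsOfSize≤ c U ∣U∣≤c)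

length-subsetsOfSize≤ : ∀ n c → length (subsetsOfSize≤ n c) ≤ suc n ^ c
length-subsetsOfSize≤ zero    c       = ≤-reflexive (sym (^-zeroˡ c))
length-subsetsOfSize≤ (suc n) zero    =
  ≤-trans (≤-reflexive (trans (length-⊎ₛ (subsetsOfSize≤ n zero) []) (+-identityʳ _))) (length-subsetsOfSize≤ n zero)
length-subsetsOfSize≤ (suc n) (suc c) = begin
  length (subsetsOfSize≤ n (suc c) ⊎ₛ subsetsOfSize≤ n c)           ≡⟨ length-⊎ₛ (subsetsOfSize≤ n (suc c)) _ ⟩
  length (subsetsOfSize≤ n (suc c)) + length (subsetsOfSize≤ n c)   ≤⟨ +-mono-≤ (length-subsetsOfSize≤ n (suc c))
                                                                               (length-subsetsOfSize≤ n c) ⟩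
  suc n * suc n ^ c + suc n ^ c                                     ≡⟨ +-comm (suc n * suc n ^ c) _ ⟩
  suc (suc n) * suc n ^ c                                           ≤⟨ *-monoʳ-≤ (suc (suc n))
                                                                                 (^-monoˡ-≤ c (n≤1+n (suc n))) ⟩
  suc (suc n) ^ suc c                                               ∎
  where open ≤-Reasoning

length-subsetsOfSize≤-≤ : ∀ {n} → 1 ≤ n → ∀ c → length (subsetsOfSize≤ n c) ≤ 2 ^ c * n ^ c
length-subsetsOfSize≤-≤ {n} n≥1 c = begin
  length (subsetsOfSize≤ n c)  ≤⟨ length-subsetsOfSize≤ n c ⟩
  suc n ^ c                    ≤⟨ ^-monoˡ-≤ c (+-monoˡ-≤ n n≥1) ⟩
  (n + n) ^ c                  ≡⟨ cong (λ x → (n + x) ^ c) (+-identityʳ n) ⟨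
  (2 * n) ^ c                  ≡⟨ ^-distribʳ-* 2 n c ⟩
  2 ^ c * n ^ c                ∎
  where open ≤-Reasoning

∣p∪q∣≤∣p∣+∣q∣ : ∀ {n} (p q : Subset n) → ∣ p ∪ q ∣ ≤ ∣ p ∣ + ∣ q ∣
∣p∪q∣≤∣p∣+∣q∣ []            []            = z≤n
∣p∪q∣≤∣p∣+∣q∣ (inside ∷ p)  (inside ∷ q)  = s≤s (≤-trans (∣p∪q∣≤∣p∣+∣q∣ p q) (+-monoʳ-≤ ∣ p ∣ (n≤1+n ∣ q ∣)))
∣p∪q∣≤∣p∣+∣q∣ (inside ∷ p)  (outside ∷ q) = s≤s (∣p∪q∣≤∣p∣+∣q∣ p q)
∣p∪q∣≤∣p∣+∣q∣ (outside ∷ p) (inside ∷ q)  = ≤-trans (s≤s (∣p∪q∣≤∣p∣+∣q∣ p q)) (≤-reflexive (sym (+-suc ∣ p ∣ ∣ q ∣)))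
∣p∪q∣≤∣p∣+∣q∣ (outside ∷ p) (outside ∷ q) = ∣p∪q∣≤∣p∣+∣q∣ p q

image : ∀ {k n} → (Fin k → Fin n) → Subset k → Subset n
image φ []            = Sub.⊥
image φ (outside ∷ p) = image (φ ∘ suc) p
image φ (inside ∷ p)  = ⁅ φ zero ⁆ ∪ image (φ ∘ suc) p

module _ {n : ℕ} where

  ∈-image⁺ : ∀ {k} (φ : Fin k → Fin n) {p x} → x ∈ₛ p → φ x ∈ₛ image φ p
  ∈-image⁺ φ {inside ∷ p}  V.here         = p⊆p∪q _ (x∈⁅x⁆ (φ zero))
  ∈-image⁺ φ {outside ∷ p} (V.there x∈p) = ∈-image⁺ (φ ∘ suc) x∈p
  ∈-image⁺ φ {inside ∷ p}  (V.there x∈p) = q⊆p∪q _ _ (∈-image⁺ (φ ∘ suc) x∈p)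

  ∈-image⁻ : ∀ {k} (φ : Fin k → Fin n) p {y} → y ∈ₛ image φ p → ∃[ x ] (x ∈ₛ p × φ x ≡ y)
  ∈-image⁻ φ []            y∈ = ⊥-elim (∉⊥ y∈)
  ∈-image⁻ φ (outside ∷ p) y∈ with x , x∈p , φx≡y ← ∈-image⁻ (φ ∘ suc) p y∈ = suc x , V.there x∈p , φx≡y
  ∈-image⁻ φ (inside ∷ p)  y∈ with x∈p∪q⁻ ⁅ φ zero ⁆ (image (φ ∘ suc) p) y∈
  ... | inj₁ y∈⁅φ0⁆ = zero , V.here , sym (x∈⁅y⁆⇒x≡y (φ zero) y∈⁅φ0⁆)
  ... | inj₂ y∈rest with x , x∈p , φx≡y ← ∈-image⁻ (φ ∘ suc) p y∈rest = suc x , V.there x∈p , φx≡y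

  ∣image∣≤∣p∣ : ∀ {k} (φ : Fin k → Fin n) p → ∣ image φ p ∣ ≤ ∣ p ∣
  ∣image∣≤∣p∣ φ []            = ≤-reflexive (∣⊥∣≡0 n)
  ∣image∣≤∣p∣ φ (outside ∷ p) = ∣image∣≤∣p∣ (φ ∘ suc) p
  ∣image∣≤∣p∣ φ (inside ∷ p)  = begin
    ∣ ⁅ φ zero ⁆ ∪ image (φ ∘ suc) p ∣        ≤⟨ ∣p∪q∣≤∣p∣+∣q∣ ⁅ φ zero ⁆ _ ⟩
    ∣ ⁅ φ zero ⁆ ∣ + ∣ image (φ ∘ suc) p ∣    ≡⟨ cong (_+ ∣ image (φ ∘ suc) p ∣) (∣⁅x⁆∣≡1 (φ zero)) ⟩
    suc ∣ image (φ ∘ suc) p ∣                 ≤⟨ s≤s (∣image∣≤∣p∣ (φ ∘ suc) p) ⟩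
    suc ∣ p ∣                                 ∎
    where open ≤-Reasoning

  IsImage⇒≡image : ∀ {k} (φ : Fin k → Fin n) {e f} → IsImage φ e f → f ≡ image φ e
  IsImage⇒≡image φ {e} (f⊆φe , φe⊆f) = ⊆-antisym f⊆image image⊆f
    where
    f⊆image : _ ⊆ image φ e
    f⊆image {y} y∈f with x , x∈e , refl ← f⊆φe y y∈f = ∈-image⁺ φ x∈e
    image⊆f : image φ e ⊆ _
    image⊆f {y} y∈ with x , x∈e , refl ← ∈-image⁻ φ e y∈ = φe⊆f x x∈e

  image-injective : ∀ {k} (φ : Fin k → Fin n) → Injective _≡_ _≡_ φ → Injective _≡_ _≡_ (image φ)
  image-injective φ φ-inj {p} {q} φp≡φq = ⊆-antisym (⊆-reflect φp≡φq) (⊆-reflect (sym φp≡φq))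
    where
    ⊆-reflect : ∀ {p q} → image φ p ≡ image φ q → p ⊆ q
    ⊆-reflect {p} {q} eq {x} x∈p
      with x′ , x′∈q , φx′≡φx ← ∈-image⁻ φ q (subst (φ x ∈ₛ_) eq (∈-image⁺ φ x∈p))
      = subst (_∈ₛ q) (φ-inj φx′≡φx) x′∈q

  image-⊆-∪∁ : ∀ {k} (φ : Fin k → Fin n) p q → image φ p ⊆ image φ q ∪ image φ (∁ q)
  image-⊆-∪∁ φ p q y∈ with x , _ , refl ← ∈-image⁻ φ p y∈ with x ∈ₛ? q
  ... | yes x∈q = p⊆p∪q _ (∈-image⁺ φ x∈q)
  ... | no  x∉q = q⊆p∪q _ _ (∈-image⁺ φ (x∉p⇒x∈∁p x∉q))

-- Counting sequences

-- Bounds on lists L of length-t sequences are densities relative to N ^ t, written without division: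
-- length L * N ^ c ≤ b * N ^ t says that L has density at most b / N ^ c.
module Words {A : Set} (R : List A) where

  N : ℕ
  N = length R

  infixr 5 _◂_
  _◂_ : ∀ {t} → List A → (A → List (Vec A t)) → List (Vec A (suc t))
  as ◂ F = concatMap (λ a → map (a ∷_) (F a)) as

  ∈-◂ : ∀ {t a as w} {F : A → List (Vec A t)} → a ∈ as → w ∈ F a → a ∷ w ∈ as ◂ F
  ∈-◂ a∈as w∈Fa = ∈-concatMap⁺ _ (lose a∈as (∈-map⁺ _ w∈Fa))

  length-◂-≤ : ∀ {t} (as : List A) (F : A → List (Vec A t)) {M b} →
               (∀ a → length (F a) * M ≤ b) → length (as ◂ F) * M ≤ length as * b
  length-◂-≤ as F {M} {b} bound = length-concatMap-≤ _ as λ a → begin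
    length (map (a ∷_) (F a)) * M ≡⟨ cong (_* M) (length-map _ (F a)) ⟩
    length (F a) * M              ≤⟨ bound a ⟩
    b                             ∎
    where open ≤-Reasoning

  words : (t : ℕ) → List (Vec A t)
  words zero    = [ [] ]
  words (suc t) = R ◂ λ _ → words t

  ∈-words : ∀ {t} (us : Vec A t) → All (_∈ R) (toList us) → us ∈ words t
  ∈-words []       []            = here refl
  ∈-words (u ∷ us) (u∈R ∷ us∈R) = ∈-◂ u∈R (∈-words us us∈R)

  length-words : ∀ t → length (words t) ≤ N ^ t
  length-words zero    = ≤-refl
  length-words (suc t) = begin
    length (words (suc t))      ≡⟨ *-identityʳ _ ⟨
    length (words (suc t)) * 1  ≤⟨ length-◂-≤ R _ (λ _ → ≤-trans (≤-reflexive (*-identityʳ _)) (length-words t)) ⟩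
    N * N ^ t                   ∎
    where open ≤-Reasoning

  module AtLeast {P : A → Set} (P? : Decidable P) (Q : List A) (Q-complete : ∀ {a} → P a → a ∈ Q) where

    atLeast : ℕ → (t : ℕ) → List (Vec A t)
    atLeast zero    t       = words t
    atLeast (suc c) zero    = []
    atLeast (suc c) (suc t) = (R ◂ λ _ → atLeast (suc c) t) ++ (Q ◂ λ _ → atLeast c t)

    ∈-atLeast : ∀ c {t} (us : Vec A t) → All (_∈ R) (toList us) → c ≤ count P? us → us ∈ atLeast c t
    ∈-atLeast zero    us       us∈R         _ = ∈-words us us∈R
    ∈-atLeast (suc c) (u ∷ us) (u∈R ∷ us∈R) c<count with P? u
    ... | yes Pu = ∈-++⁺ʳ (R ◂ _) (∈-◂ (Q-complete Pu) (∈-atLeast c us us∈R (s≤s⁻¹ c<count)))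
    ... | no _   = ∈-++⁺ˡ (∈-◂ u∈R (∈-atLeast (suc c) us us∈R c<count))

    length-atLeast : ∀ {B} → length Q ≤ B → ∀ c t → length (atLeast c t) * N ^ c ≤ B ^ c * t ^ c * N ^ t
    length-atLeast _ zero t = begin
      length (words t) * 1  ≡⟨ *-identityʳ _ ⟩
      length (words t)      ≤⟨ length-words t ⟩
      N ^ t                 ≡⟨ +-identityʳ (N ^ t) ⟨
      1 * 1 * N ^ t         ∎
      where open ≤-Reasoning
    length-atLeast _ (suc c) zero = z≤n
    length-atLeast {B} Q≤B (suc c) (suc t) = begin
      length (Rs ++ Qs) * N ^ suc c
        ≡⟨ length-++-* Rs (N ^ suc c) ⟩
      length Rs * N ^ suc c + length Qs * N ^ suc c
        ≤⟨ +-mono-≤ (length-◂-≤ R _ λ _ → length-atLeast Q≤B (suc c) t)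
                    (length-◂-≤ Q _ λ _ → one-fewer) ⟩
      N * (B ^ suc c * t ^ suc c * N ^ t) + length Q * (N * (B ^ c * t ^ c * N ^ t))
        ≤⟨ +-monoʳ-≤ _ (*-monoˡ-≤ _ Q≤B) ⟩
      N * (B * B ^ c * (t * t ^ c) * N ^ t) + B * (N * (B ^ c * t ^ c * N ^ t))
        ≡⟨ regroup N B (B ^ c) t (t ^ c) (N ^ t) ⟩
      B * B ^ c * (suc t * t ^ c) * (N * N ^ t)
        ≤⟨ *-monoˡ-≤ _ (*-monoʳ-≤ (B ^ suc c) (*-monoʳ-≤ (suc t) (^-monoˡ-≤ c (n≤1+n t)))) ⟩
      B ^ suc c * suc t ^ suc c * N ^ suc t
        ∎
      where
      open ≤-Reasoning
      Rs = R ◂ λ _ → atLeast (suc c) t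
      Qs = Q ◂ λ _ → atLeast c t
      one-fewer : length (atLeast c t) * N ^ suc c ≤ N * (B ^ c * t ^ c * N ^ t)
      one-fewer = begin
        length (atLeast c t) * (N * N ^ c) ≡⟨ x∙yz≈y∙xz (length (atLeast c t)) N (N ^ c) ⟩
        N * (length (atLeast c t) * N ^ c) ≤⟨ *-monoʳ-≤ N (length-atLeast Q≤B c t) ⟩
        N * (B ^ c * t ^ c * N ^ t)        ∎
      regroup : ∀ N B Bc t tc Nt → N * (B * Bc * (t * tc) * Nt) + B * (N * (Bc * tc * Nt))
                                 ≡ B * Bc * ((1 + t) * tc) * (N * Nt)
      regroup = solve-∀

  module FirstHit {H : Set} (next : H → A → H) (W : ∀ {t} → H → A → List (Vec A t)) where

    firstHit : H → (t : ℕ) → List (Vec A t)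
    firstHit h zero    = []
    firstHit h (suc t) = R ◂ λ u → firstHit (next h u) t ++ W h u

    ∈-firstHit-now : ∀ {h t u} {us : Vec A t} → u ∈ R → us ∈ W h u → u ∷ us ∈ firstHit h (suc t)
    ∈-firstHit-now u∈R us∈W = ∈-◂ u∈R (∈-++⁺ʳ _ us∈W)

    ∈-firstHit-later : ∀ {h t u} {us : Vec A t} → u ∈ R → us ∈ firstHit (next h u) t →
                       u ∷ us ∈ firstHit h (suc t)
    ∈-firstHit-later u∈R us∈F = ∈-◂ u∈R (∈-++⁺ˡ us∈F)

    length-firstHit-≤ : ∀ {M} (G : ℕ → ℕ) → (∀ {t} h u → length (W {t} h u) * M ≤ G t) →
                      (∀ t → N * G t ≤ G (suc t)) → ∀ h t → length (firstHit h t) * M ≤ t * G t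
    length-firstHit-≤ G W≤G G-growth h zero = z≤n
    length-firstHit-≤ {M} G W≤G G-growth h (suc t) = begin
      length (firstHit h (suc t)) * M ≤⟨ length-◂-≤ R _ step ⟩
      N * (suc t * G t)               ≡⟨ x∙yz≈y∙xz N (suc t) (G t) ⟩
      suc t * (N * G t)               ≤⟨ *-monoʳ-≤ (suc t) (G-growth t) ⟩
      suc t * G (suc t)               ∎
      where
      open ≤-Reasoning
      step : ∀ u → length (firstHit (next h u) t ++ W h u) * M ≤ suc t * G t
      step u = begin
        length (firstHit (next h u) t ++ W h u) * M              ≡⟨ length-++-* (firstHit (next h u) t) M ⟩
        length (firstHit (next h u) t) * M + length (W h u) * M
          ≤⟨ +-mono-≤ (length-firstHit-≤ G W≤G G-growth (next h u) t) (W≤G h u) ⟩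
        t * G t + G t                                            ≡⟨ +-comm (t * G t) (G t) ⟩
        suc t * G t                                              ∎

-- The process

module Game (S : Strategy) {n : ℕ} where

  open import Data.List.Membership.DecPropositional (≡-dec {n = n} _≟ᵇ_) using (_∈?_)

  History : Set
  History = List (Subset n × Subset n)

  move : History → Subset n → History
  move h U = h ++ [ (U , S n h U) ]

  edgesFrom : ∀ {t} → History → Vec (Subset n) t → List (Subset n)
  edgesFrom h []       = []
  edgesFrom h (U ∷ Us) = U ∪ S n h U ∷ edgesFrom (move h U) Us

  edgesOf-play : ∀ {t} h (Us : Vec (Subset n) t) →
                 map edgeOf (play S n h (toList Us)) ≡ map edgeOf h ++ edgesFrom h Us
  edgesOf-play h []       = sym (++-identityʳ (map edgeOf h))
  edgesOf-play h (U ∷ Us) = begin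
    map edgeOf (play S n (move h U) (toList Us))          ≡⟨ edgesOf-play (move h U) Us ⟩
    map edgeOf (move h U) ++ edgesFrom (move h U) Us      ≡⟨ cong (_++ edgesFrom (move h U) Us) (map-++ edgeOf h _) ⟩
    (map edgeOf h ++ [ U ∪ S n h U ]) ++ edgesFrom (move h U) Us
                                                          ≡⟨ ++-assoc (map edgeOf h) _ _ ⟩
    map edgeOf h ++ edgesFrom h (U ∷ Us)                  ∎
    where open ≡-Reasoning

  hyperEdges≡edgesFrom : ∀ {t} (Us : Vec (Subset n) t) → hyperEdges S n t Us ≡ edgesFrom [] Us
  hyperEdges≡edgesFrom = edgesOf-play []

  length-filter-edgesFrom : ∀ {t} Y h (Us : Vec (Subset n) t) →
                            length (filter (_⊆? Y) (edgesFrom h Us)) ≤ count (_⊆? Y) Us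
  length-filter-edgesFrom Y h []       = z≤n
  length-filter-edgesFrom Y h (U ∷ Us) with (U ∪ S n h U) ⊆? Y | U ⊆? Y
  ... | yes _    | yes _ = s≤s (length-filter-edgesFrom Y (move h U) Us)
  ... | yes U∪V⊆Y | no U⊈Y = ⊥-elim (U⊈Y (U∪V⊆Y ∘ p⊆p∪q (S n h U)))
  ... | no _     | yes _ = m≤n⇒m≤1+n (length-filter-edgesFrom Y (move h U) Us)
  ... | no _     | no _  = length-filter-edgesFrom Y (move h U) Us

  module FirstCopyEdge (R XS : List (Subset n)) (K c : ℕ) where

    open Words R

    -- Empty unless ∣ Y ∣ ≤ K, so that the cover subsetsOf Y of the hits has at most 2 ^ K elements.
    withHitsIn : Subset n → (t : ℕ) → List (Vec (Subset n) t)
    withHitsIn Y t with ∣ Y ∣ ≤? K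
    ... | yes _ = AtLeast.atLeast (_⊆? Y) (subsetsOf Y) ∈-subsetsOf c t
    ... | no  _ = []

    ∈-withHitsIn : ∀ {t} Y (Us : Vec (Subset n) t) → All (_∈ R) (toList Us) → ∣ Y ∣ ≤ K →
                   c ≤ count (_⊆? Y) Us → Us ∈ withHitsIn Y t
    ∈-withHitsIn Y Us Us∈R ∣Y∣≤K c≤count with ∣ Y ∣ ≤? K
    ... | yes _    = AtLeast.∈-atLeast (_⊆? Y) (subsetsOf Y) ∈-subsetsOf c Us Us∈R c≤count
    ... | no ∣Y∣≰K = ⊥-elim (∣Y∣≰K ∣Y∣≤K)

    length-withHitsIn : ∀ Y t → length (withHitsIn Y t) * N ^ c ≤ (2 ^ K) ^ c * t ^ c * N ^ t
    length-withHitsIn Y t with ∣ Y ∣ ≤? K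
    ... | yes ∣Y∣≤K = AtLeast.length-atLeast (_⊆? Y) (subsetsOf Y) ∈-subsetsOf
                        (≤-trans (≤-reflexive (length-subsetsOf Y)) (^-monoʳ-≤ 2 ∣Y∣≤K)) c t
    ... | no  _     = z≤n

    open FirstHit move (λ {t} h U → concatMap (λ X → withHitsIn ((U ∪ S n h U) ∪ X) t) XS) public

    Anchored : List (Subset n) → Set
    Anchored T = ∀ {f} → f ∈ T → ∃[ X ] (X ∈ XS × ∣ f ∪ X ∣ ≤ K × All (_⊆ f ∪ X) T)

    ∈-firstHit : ∀ {t} h (Us : Vec (Subset n) t) → All (_∈ R) (toList Us) →
                 (T : List (Subset n)) → Unique T → length T ≡ suc c → Anchored T →
                 All (_∈ edgesFrom h Us) T → Us ∈ firstHit h t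
    ∈-firstHit h [] _ []      _ () _ _
    ∈-firstHit h [] _ (_ ∷ _) _ _  _ (() ∷ _)
    ∈-firstHit h (U ∷ Us) (U∈R ∷ Us∈R) T T-unique ∣T∣≡1+c anchored T⊆edges with U ∪ S n h U ∈? T
    ... | no f∉T = ∈-firstHit-later U∈R (∈-firstHit (move h U) Us Us∈R T T-unique ∣T∣≡1+c anchored T⊆later)
      where
      T⊆later = All.tabulate λ g∈T → ∈-∷⁻ (All.lookup T⊆edges g∈T) λ { refl → f∉T g∈T }
    ... | yes f∈T with X , X∈XS , ∣Y∣≤K , T⊆Y ← anchored f∈T =
      ∈-firstHit-now U∈R (∈-concatMap⁺ _ (lose X∈XS (∈-withHitsIn _ Us Us∈R ∣Y∣≤K c≤count)))
      where
      Y = (U ∪ S n h U) ∪ X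
      -- The other c edges of T are distinct later edges inside Y, and a random set lies in its edge.
      c≤count : c ≤ count (_⊆? Y) Us
      c≤count = s≤s⁻¹ (begin
        suc c                                                        ≡⟨ ∣T∣≡1+c ⟨
        length T                                                     ≤⟨ length-≤-unique T-unique
                                                                          (All.zipWith keep (T⊆edges , T⊆Y)) ⟩
        suc (length (filter (_⊆? Y) (edgesFrom (move h U) Us)))      ≤⟨ s≤s (length-filter-edgesFrom Y (move h U) Us) ⟩
        suc (count (_⊆? Y) Us)                                       ∎)
        where
        open ≤-Reasoning
        keep : ∀ {g} → g ∈ edgesFrom h (U ∷ Us) × g ⊆ Y → g ∈ U ∪ S n h U ∷ filter (_⊆? Y) (edgesFrom (move h U) Us)
        keep (g∈ , g⊆Y) = ∈-∷-filter⁺ (_⊆? Y) g∈ g⊆Y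

    length-firstHit : ∀ h t → length (firstHit h t) * N ^ c ≤ t * (length XS * ((2 ^ K) ^ c * t ^ c * N ^ t))
    length-firstHit = length-firstHit-≤ G W≤G G-growth
      where
      G : ℕ → ℕ
      G t = length XS * ((2 ^ K) ^ c * t ^ c * N ^ t)
      W≤G : ∀ {t} h U → length (concatMap (λ X → withHitsIn ((U ∪ S n h U) ∪ X) t) XS) * N ^ c ≤ G t
      W≤G {t} h U = length-concatMap-≤ _ XS λ X → length-withHitsIn ((U ∪ S n h U) ∪ X) t
      G-growth : ∀ t → N * G t ≤ G (suc t)
      G-growth t = begin
        N * (length XS * (Bt * N ^ t))          ≡⟨ x∙yz≈y∙xz N (length XS) _ ⟩
        length XS * (N * (Bt * N ^ t))          ≡⟨ cong (length XS *_) (x∙yz≈y∙xz N Bt (N ^ t)) ⟩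
        length XS * (Bt * N ^ suc t)            ≤⟨ *-monoʳ-≤ (length XS) (*-monoˡ-≤ (N ^ suc t)
                                                     (*-monoʳ-≤ ((2 ^ K) ^ c) (^-monoˡ-≤ c (n≤1+n t)))) ⟩
        length XS * ((2 ^ K) ^ c * suc t ^ c * N ^ suc t)  ∎
        where
        open ≤-Reasoning
        Bt = (2 ^ K) ^ c * t ^ c

-- Copies of H

-- 2 ^ (k ∸ s) from the choices of X, and per later hit 2 ^ k from the subsets of Y and 2 ^ r * r !
-- from n ^ r ≤ 2 ^ r * r ! * (n C r).
copyConstant : (k s r m′ : ℕ) → ℕ
copyConstant k s r m′ = 2 ^ (k ∸ s) * (2 ^ k * (2 ^ r * r !)) ^ m′

module _ {k s r n : ℕ} (S : Strategy) {HE : List (Subset k)} (s≤k : s ≤ k) (HE-unique : Unique HE)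
         (HE-uniform : All (λ e → ∣ e ∣ ≡ s) HE) {m′ : ℕ} (∣HE∣≡1+m′ : length HE ≡ suc m′) where

  open Game S {n}
  open FirstCopyEdge (subsetsOfSize n r) (subsetsOfSize≤ n (k ∸ s)) k m′

  copy⇒∈firstHit : ∀ {T} {Us : Vec (Subset n) T} → RSeq r n T Us × ContainsCopy k n HE (hyperEdges S n T Us) →
                   Us ∈ firstHit [] T
  copy⇒∈firstHit {Us = Us} (Us-r , φ , φ-injective , HE↪G) =
    ∈-firstHit [] Us (All.map (∈-subsetsOfSize r _) Us-r) (map (image φ) HE)
      (Unique.map⁺ (image-injective φ φ-injective) HE-unique) (trans (length-map _ HE) ∣HE∣≡1+m′)
      anchored copy⊆edges
    where
    copy⊆edges : All (_∈ edgesFrom [] Us) (map (image φ) HE)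
    copy⊆edges = All.map⁺ (All.map (λ {e} e↪G → subst (image φ e ∈_) (hyperEdges≡edgesFrom Us)
                                                 (Any.map (sym ∘ IsImage⇒≡image φ) e↪G)) HE↪G)
    anchored : Anchored (map (image φ) HE)
    anchored f∈ with e , e∈HE , refl ← ∈-map⁻ (image φ) f∈ =
      image φ (∁ e) , ∈-subsetsOfSize≤ (k ∸ s) _ ∣X∣≤k∸s , ∣Y∣≤k , All.tabulate copy⊆Y
      where
      ∣e∣≡s = All.lookup HE-uniform e∈HE
      ∣X∣≤k∸s : ∣ image φ (∁ e) ∣ ≤ k ∸ s
      ∣X∣≤k∸s = ≤-trans (∣image∣≤∣p∣ φ (∁ e)) (≤-reflexive (trans (∣∁p∣≡n∸∣p∣ e) (cong (k ∸_) ∣e∣≡s)))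
      ∣Y∣≤k : ∣ image φ e ∪ image φ (∁ e) ∣ ≤ k
      ∣Y∣≤k = begin
        ∣ image φ e ∪ image φ (∁ e) ∣          ≤⟨ ∣p∪q∣≤∣p∣+∣q∣ (image φ e) _ ⟩
        ∣ image φ e ∣ + ∣ image φ (∁ e) ∣      ≤⟨ +-mono-≤ (≤-trans (∣image∣≤∣p∣ φ e) (≤-reflexive ∣e∣≡s)) ∣X∣≤k∸s ⟩
        s + (k ∸ s)                            ≡⟨ m+[n∸m]≡n s≤k ⟩
        k                                      ∎
        where open ≤-Reasoning
      copy⊆Y : ∀ {g} → g ∈ map (image φ) HE → g ⊆ image φ e ∪ image φ (∁ e)
      copy⊆Y g∈ with e′ , _ , refl ← ∈-map⁻ (image φ) g∈ = image-⊆-∪∁ φ e′ e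

  first-moment-bound : 1 ≤ n → 2 * r ≤ n → ∀ T (L : List (Vec (Subset n) T)) → Unique L →
                       All (λ Us → RSeq r n T Us × ContainsCopy k n HE (hyperEdges S n T Us)) L →
                       length L * n ^ (r * suc m′) ≤ copyConstant k s r m′ * (T ^ suc m′ * n ^ (k ∸ s + r)) * (n C r) ^ T
  first-moment-bound n≥1 2r≤n T L L-unique L-bad = begin
    length L * n ^ (r * suc m′)
      ≡⟨ cong (length L *_) (^-*-assoc n r (suc m′)) ⟨
    length L * (n ^ r * (n ^ r) ^ m′)
      ≤⟨ *-monoʳ-≤ (length L) (*-monoʳ-≤ (n ^ r) (^-monoˡ-≤ m′ n^r≤D*N)) ⟩
    length L * (n ^ r * (D * N) ^ m′)
      ≡⟨ cong (λ x → length L * (n ^ r * x)) (^-distribʳ-* D N m′) ⟩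
    length L * (n ^ r * (D ^ m′ * N ^ m′))
      ≡⟨ regroupˡ (length L) (n ^ r) (D ^ m′) (N ^ m′) ⟩
    n ^ r * D ^ m′ * (length L * N ^ m′)
      ≤⟨ *-monoʳ-≤ (n ^ r * D ^ m′) (*-monoˡ-≤ (N ^ m′) (length-≤-unique L-unique (All.map copy⇒∈firstHit L-bad))) ⟩
    n ^ r * D ^ m′ * (length (firstHit [] T) * N ^ m′)
      ≤⟨ *-monoʳ-≤ (n ^ r * D ^ m′) (length-firstHit [] T) ⟩
    n ^ r * D ^ m′ * (T * (length XS * (B ^ m′ * T ^ m′ * N ^ T)))
      ≤⟨ *-monoʳ-≤ (n ^ r * D ^ m′) (*-monoʳ-≤ T (*-monoˡ-≤ (B ^ m′ * T ^ m′ * N ^ T)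
                                                               (length-subsetsOfSize≤-≤ n≥1 (k ∸ s)))) ⟩
    n ^ r * D ^ m′ * (T * (2 ^ (k ∸ s) * n ^ (k ∸ s) * (B ^ m′ * T ^ m′ * N ^ T)))
      ≡⟨ regroupʳ (n ^ r) (D ^ m′) T (2 ^ (k ∸ s)) (n ^ (k ∸ s)) (B ^ m′) (T ^ m′) (N ^ T) ⟩
    2 ^ (k ∸ s) * (B ^ m′ * D ^ m′) * (T ^ suc m′ * (n ^ (k ∸ s) * n ^ r)) * N ^ T
      ≡⟨ cong (λ x → 2 ^ (k ∸ s) * (B ^ m′ * D ^ m′) * (T ^ suc m′ * x) * N ^ T) (^-distribˡ-+-* n (k ∸ s) r) ⟨
    2 ^ (k ∸ s) * (B ^ m′ * D ^ m′) * (T ^ suc m′ * n ^ (k ∸ s + r)) * N ^ T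
      ≡⟨ cong₂ (λ x y → 2 ^ (k ∸ s) * x * (T ^ suc m′ * n ^ (k ∸ s + r)) * y ^ T)
               (^-distribʳ-* B D m′) (sym (length-subsetsOfSize n r)) ⟨
    copyConstant k s r m′ * (T ^ suc m′ * n ^ (k ∸ s + r)) * (n C r) ^ T
      ∎
    where
    open ≤-Reasoning
    open Words (subsetsOfSize n r) using (N)
    XS = subsetsOfSize≤ n (k ∸ s)
    B = 2 ^ k
    D = 2 ^ r * r !
    n^r≤D*N : n ^ r ≤ D * N
    n^r≤D*N = subst (λ x → n ^ r ≤ D * x) (sym (length-subsetsOfSize n r)) (n^k≤2^k*k!*nCk {k = r} 2r≤n)
    regroupˡ : ∀ a p d x → a * (p * (d * x)) ≡ p * d * (a * x)
    regroupˡ = solve-∀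
    regroupʳ : ∀ p d t b x c u v → p * d * (t * (b * x * (c * u * v))) ≡ b * (c * d) * (t * u * (x * p)) * v
    regroupʳ = solve-∀

theorem2 : (k s r : ℕ) → s ≤ k → r ≤ s → 1 ≤ r →
    (HE : List (Subset k)) → Unique HE → All (λ e → ∣ e ∣ ≡ s) HE →
    1 ≤ length HE →
    (S : Strategy) → ValidStrategy r s S →
    (t : ℕ → ℕ) → LittleO k s r (length HE) t →
    AASNoCopy k s r HE S t
theorem2 k s r s≤k _ _ []              _         _          () S _ t t-small
theorem2 k s r s≤k _ _ HE@(_ ∷ HE′) HE-unique HE-uniform _  S _ t t-small j = N₀ + suc (2 * r) , bound
  where
  J = suc j * copyConstant k s r (length HE′)
  N₀ = proj₁ (t-small J)
  bound : ∀ n → N₀ + suc (2 * r) ≤ n → (L : List (Vec (Subset n) (t n))) → Unique L →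
          All (λ Us → RSeq r n (t n) Us × ContainsCopy k n HE (hyperEdges S n (t n) Us)) L →
          suc j * length L ≤ (n C r) ^ t n
  bound n n-large L L-unique L-bad =
    ≤-from-ratio j {{m^n≢0 n (r * length HE) {{>-nonZero n≥1}}}}
      (first-moment-bound S s≤k HE-unique HE-uniform refl n≥1 (<⇒≤ 2r<n) (t n) L L-unique L-bad)
      (n≤1+n J) (proj₂ (t-small J) n (m+n≤o⇒m≤o N₀ n-large))
    where
    2r<n = m+n≤o⇒n≤o N₀ n-large
    n≥1 = ≤-trans (s≤s z≤n) 2r<n
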